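{- Let $G=(V,E,\mathbf w)$ be a weighted undirected graph and let $(u_i,v_i)$, $R_i$ be the iterates of the UGA for graph sparsification described in the context. Then for all $i\ge1$, $$\|R_i\|_F^2\le\|R_{i-1}\|_F^2-\frac{\langle R_{i-1},\phi_{(u_i,v_i)}\rangle^2}{4}.$$
   Context: $\mathbf e_u$ are standard basis vectors, $\phi_{(u,v)}=(\mathbf e_u-\mathbf e_v)(\mathbf e_u-\mathbf e_v)^\top$, $L_G=\sum_{(u,v)\in E}w_{(u,v)}\phi_{(u,v)}$ with $w_{(u,v)}>0$; $\langle X,Y\rangle=\mathrm{tr}(X^\top Y)$ and $\|\cdot\|_F$ the Frobenius norm. The UGA for graph sparsification: $R_0=L_G$, $L_{H_0}=0$; for $i=1,2,\dots$: choose $(u_i,v_i)\in E$ maximizing $|\langle\phi_{(u,v)},R_{i-1}\rangle|$ over $(u,v)\in E$; compute $(\alpha_1^i,\alpha_2^i)\in\arg\min_{(\alpha_1,\alpha_2)\in\mathbb R^2}\|L_G-\alpha_1L_{H_{i-1}}-\alpha_2\phi_{(u_i,v_i)}\|_F^2$; set $L_{H_i}=\alpha_1^iL_{H_{i-1}}+\alpha_2^i\phi_{(u_i,v_i)}$ and $R_i=L_G-L_{H_i}$. -}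

module Defs where

open import Level using (Level; _⊔_) renaming (suc to lsuc)
open import Data.Nat using (ℕ; zero; suc)
open import Data.Fin using (Fin; zero; suc)
open import Data.Product using (_×_; _,_)
open import Relation.Nullary using (¬_)
open import Relation.Binary.Core using (Rel)
open import Relation.Binary.Structures using (IsTotalOrder)
open import Relation.Binary.PropositionalEquality using (_≡_)
open import Algebra.Bundles using (CommutativeRing)

-- An ordered field (the reals ℝ are an instance).  The inverse is total,
-- with the usual law only for nonzero arguments; ∣_∣ is the absolute value,
-- specified by its two defining cases.
record OrderedField (c ℓ₁ ℓ₂ : Level) : Set (lsuc (c ⊔ ℓ₁ ⊔ ℓ₂)) where
  field
    commutativeRing : CommutativeRing c ℓ₁
  open CommutativeRing commutativeRing public
  infix 4 _≤_ _<_
  field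
    _≤_          : Rel Carrier ℓ₂
    isTotalOrder : IsTotalOrder _≈_ _≤_
    +-mono-≤     : ∀ {x y} z → x ≤ y → x + z ≤ y + z
    *-nonneg     : ∀ {x y} → 0# ≤ x → 0# ≤ y → 0# ≤ x * y
    0≉1          : ¬ (0# ≈ 1#)
    _⁻¹          : Carrier → Carrier
    ⁻¹-inverse   : ∀ x → ¬ (x ≈ 0#) → x * (x ⁻¹) ≈ 1#
    ∣_∣          : Carrier → Carrier
    ∣∣-nonneg    : ∀ x → 0# ≤ x → ∣ x ∣ ≈ x
    ∣∣-nonpos    : ∀ x → x ≤ 0# → ∣ x ∣ ≈ - x

  _<_ : Rel Carrier (ℓ₁ ⊔ ℓ₂)
  x < y = (x ≤ y) × ¬ (x ≈ y)

module _ {c ℓ₁ ℓ₂ : Level} (F : OrderedField c ℓ₁ ℓ₂) where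
  open OrderedField F using (Carrier; _+_; _*_; _-_; 0#; 1#; _≤_; ∣_∣)

  Vec′ : ℕ → Set c
  Vec′ n = Fin n → Carrier

  Mat : ℕ → Set c
  Mat n = Fin n → Fin n → Carrier

  Σ : ∀ {n} → (Fin n → Carrier) → Carrier
  Σ {zero}  f = 0#
  Σ {suc n} f = f zero + Σ (λ k → f (suc k))

  basis : ∀ {n} → Fin n → Vec′ n
  basis zero    zero    = 1#
  basis zero    (suc j) = 0#
  basis (suc u) zero    = 0#
  basis (suc u) (suc j) = basis u j

  φ : ∀ {n} → Fin n × Fin n → Mat n
  φ (u , v) i j = (basis u i - basis v i) * (basis u j - basis v j)

  0M : ∀ {n} → Mat n
  0M i j = 0#

  _+M_ : ∀ {n} → Mat n → Mat n → Mat n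
  (X +M Y) i j = X i j + Y i j

  _-M_ : ∀ {n} → Mat n → Mat n → Mat n
  (X -M Y) i j = X i j - Y i j

  _•M_ : ∀ {n} → Carrier → Mat n → Mat n
  (a •M X) i j = a * X i j

  ⟨_,_⟩ : ∀ {n} → Mat n → Mat n → Carrier
  ⟨ X , Y ⟩ = Σ (λ j → Σ (λ i → X i j * Y i j))

  ‖_‖²F : ∀ {n} → Mat n → Carrier
  ‖ X ‖²F = ⟨ X , X ⟩

  -- weighted graph Laplacian  L_G = Σ_{e ∈ E} w_e φ_e,
  -- with the edge set E given by an enumeration  ends : Fin m → V × V
  laplacian : ∀ {n m} → (Fin m → Fin n × Fin n) → (Fin m → Carrier) → Mat n
  laplacian ends w i j = Σ (λ k → w k * φ (ends k) i j)

  -- UGA iterates L_{H_i}, given the selected edges sel i = (u_i,v_i)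
  -- and the coefficients α₁ i, α₂ i (only i ≥ 1 is used).
  LH : ∀ {n m} → (Fin m → Fin n × Fin n) → (ℕ → Fin m)
     → (ℕ → Carrier) → (ℕ → Carrier) → ℕ → Mat n
  LH ends sel α₁ α₂ zero    = 0M
  LH ends sel α₁ α₂ (suc i) =
    (α₁ (suc i) •M LH ends sel α₁ α₂ i) +M (α₂ (suc i) •M φ (ends (sel (suc i))))

  Res : ∀ {n m} → (Fin m → Fin n × Fin n) → (Fin m → Carrier) → (ℕ → Fin m)
      → (ℕ → Carrier) → (ℕ → Carrier) → ℕ → Mat n
  Res ends w sel α₁ α₂ i = laplacian ends w -M LH ends sel α₁ α₂ i

  IsUGARun : ∀ {n m} → (Fin m → Fin n × Fin n) → (Fin m → Carrier)
           → (ℕ → Fin m) → (ℕ → Carrier) → (ℕ → Carrier) → Set (c ⊔ ℓ₂)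
  IsUGARun {n} {m} ends w sel α₁ α₂ =
    ∀ (i : ℕ) →
      (∀ (k : Fin m) →
         ∣ ⟨ φ (ends k) , Res ends w sel α₁ α₂ i ⟩ ∣
           ≤ ∣ ⟨ φ (ends (sel (suc i))) , Res ends w sel α₁ α₂ i ⟩ ∣)
    × (∀ (a b : Carrier) →
         ‖ (laplacian ends w -M (α₁ (suc i) •M LH ends sel α₁ α₂ i))
             -M (α₂ (suc i) •M φ (ends (sel (suc i)))) ‖²F
           ≤ ‖ (laplacian ends w -M (a •M LH ends sel α₁ α₂ i))
             -M (b •M φ (ends (sel (suc i)))) ‖²F)

-- The idea: (α₁,α₂) minimises ‖L_G - α₁ L_{H_{i-1}} - α₂ φ‖²_F, so R_i is no
-- larger in norm than the competitor obtained from (α₁,α₂) = (1,β), which is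
-- R_{i-1} - β φ.  Choosing β = ⟨R_{i-1},φ⟩ / ‖φ‖²_F makes R_{i-1} - β φ
-- orthogonal to φ, whence (Pythagoras) ‖R_{i-1} - βφ‖² = ‖R_{i-1}‖² - β⟨R_{i-1},φ⟩,
-- and ‖φ‖²_F = 4 because φ = d dᵀ with d = e_u - e_v, ‖d‖² = 2.
module Submission where

open import Defs
open import Level using (Level)
open import Data.Nat using (ℕ; zero; suc)
open import Data.Fin using (Fin; zero; suc)
open import Data.Product using (_×_; _,_; proj₁; proj₂)
open import Data.Sum using (inj₁; inj₂)
open import Relation.Nullary using (¬_)
open import Relation.Binary.PropositionalEquality as ≡ using (_≡_)
open import Relation.Binary.Bundles using (Poset)
open import Relation.Binary.Structures using (IsTotalOrder)
import Algebra.Properties.Ring as RingProperties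
import Algebra.Properties.Semiring.Sum as SumProperties
import Algebra.Properties.CommutativeSemigroup as CommSemigroupProperties
import Relation.Binary.Reasoning.Setoid as SetoidReasoning
import Relation.Binary.Reasoning.PartialOrder as OrderReasoning

module UGA {c ℓ₁ ℓ₂ : Level} (F : OrderedField c ℓ₁ ℓ₂) where
  open OrderedField F hiding (zero)
  open RingProperties ring using (-0#≈0#; -‿involutive; -‿+-comm; -1*x≈-x; -‿distribˡ-*; [y-z]x≈yx-zx)
  open SumProperties semiring using (sum; sum-cong-≋; sum-replicate-zero; ∑-distrib-+; *-distribˡ-sum; *-distribʳ-sum)
  open CommSemigroupProperties *-commutativeSemigroup using (interchange; xy∙z≈xz∙y)
  open SetoidReasoning setoid
  module ≤ = IsTotalOrder isTotalOrder

  ∑ : ∀ {n} → (Fin n → Carrier) → Carrier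
  ∑ = Σ F

  ⟪_,_⟫ : ∀ {n} → Mat F n → Mat F n → Carrier
  ⟪_,_⟫ = ⟨_,_⟩ F

  ‖_‖² : ∀ {n} → Mat F n → Carrier
  ‖_‖² = ‖_‖²F F

  infix 4 _≐_
  infixl 6 _⊕_ _⊝_
  infixl 7 _·_
  _⊕_ : ∀ {n} → Mat F n → Mat F n → Mat F n
  _⊕_ = _+M_ F

  _⊝_ : ∀ {n} → Mat F n → Mat F n → Mat F n
  _⊝_ = _-M_ F

  _·_ : ∀ {n} → Carrier → Mat F n → Mat F n
  _·_ = _•M_ F

  _≐_ : ∀ {n} → Mat F n → Mat F n → Set ℓ₁
  X ≐ Y = ∀ i j → X i j ≈ Y i j

  -- Defs' Σ is the library's `sum`; this lets us reuse its lemmas.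
  ∑≡sum : ∀ {n} (f : Fin n → Carrier) → ∑ f ≡ sum f
  ∑≡sum {zero}  f = ≡.refl
  ∑≡sum {suc n} f = ≡.cong (f zero +_) (∑≡sum (λ k → f (suc k)))

  ∑-cong : ∀ {n} {f g : Fin n → Carrier} → (∀ k → f k ≈ g k) → ∑ f ≈ ∑ g
  ∑-cong {f = f} {g} f≈g = begin
    ∑ f   ≡⟨ ∑≡sum f ⟩
    sum f ≈⟨ sum-cong-≋ f≈g ⟩
    sum g ≡⟨ ∑≡sum g ⟨
    ∑ g   ∎

  ∑-zero : ∀ {n} → ∑ {n} (λ _ → 0#) ≈ 0#
  ∑-zero {n} = trans (reflexive (∑≡sum {n} (λ _ → 0#))) (sum-replicate-zero n)

  ∑-scaleˡ : ∀ {n} (a : Carrier) (f : Fin n → Carrier) → ∑ (λ k → a * f k) ≈ a * ∑ f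
  ∑-scaleˡ a f = begin
    ∑ (λ k → a * f k)   ≡⟨ ∑≡sum (λ k → a * f k) ⟩
    sum (λ k → a * f k) ≈⟨ *-distribˡ-sum a f ⟨
    a * sum f           ≡⟨ ≡.cong (a *_) (∑≡sum f) ⟨
    a * ∑ f             ∎

  ∑-scaleʳ : ∀ {n} (a : Carrier) (f : Fin n → Carrier) → ∑ (λ k → f k * a) ≈ ∑ f * a
  ∑-scaleʳ a f = begin
    ∑ (λ k → f k * a)   ≡⟨ ∑≡sum (λ k → f k * a) ⟩
    sum (λ k → f k * a) ≈⟨ *-distribʳ-sum a f ⟨
    sum f * a           ≡⟨ ≡.cong (_* a) (∑≡sum f) ⟨
    ∑ f * a             ∎

  ∑-linear : ∀ {n} (a : Carrier) (f g : Fin n → Carrier) →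
             ∑ (λ k → f k - a * g k) ≈ ∑ f - a * ∑ g
  ∑-linear a f g = begin
    ∑ (λ k → f k - a * g k)           ≡⟨ ∑≡sum (λ k → f k - a * g k) ⟩
    sum (λ k → f k - a * g k)         ≈⟨ ∑-distrib-+ f (λ k → - (a * g k)) ⟩
    sum f + sum (λ k → - (a * g k))   ≡⟨ ≡.cong₂ _+_ (∑≡sum f) (∑≡sum (λ k → - (a * g k))) ⟨
    ∑ f + ∑ (λ k → - (a * g k))       ≈⟨ +-congˡ (∑-cong (λ k → -‿distribˡ-* a (g k))) ⟩
    ∑ f + ∑ (λ k → - a * g k)         ≈⟨ +-congˡ (∑-scaleˡ (- a) g) ⟩
    ∑ f + - a * ∑ g                   ≈⟨ +-congˡ (-‿distribˡ-* a (∑ g)) ⟨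
    ∑ f - a * ∑ g                     ∎

  ⟪⟫-cong : ∀ {n} {X X′ Y Y′ : Mat F n} → X ≐ X′ → Y ≐ Y′ → ⟪ X , Y ⟫ ≈ ⟪ X′ , Y′ ⟫
  ⟪⟫-cong X≐X′ Y≐Y′ = ∑-cong (λ j → ∑-cong (λ i → *-cong (X≐X′ i j) (Y≐Y′ i j)))

  ⟪⟫-comm : ∀ {n} (X Y : Mat F n) → ⟪ X , Y ⟫ ≈ ⟪ Y , X ⟫
  ⟪⟫-comm X Y = ∑-cong (λ j → ∑-cong (λ i → *-comm (X i j) (Y i j)))

  ⟪⟫-linearˡ : ∀ {n} (a : Carrier) (X Y Z : Mat F n) →
               ⟪ X ⊝ a · Y , Z ⟫ ≈ ⟪ X , Z ⟫ - a * ⟪ Y , Z ⟫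
  ⟪⟫-linearˡ a X Y Z = begin
    ∑ (λ j → ∑ (λ i → (X i j - a * Y i j) * Z i j))
      ≈⟨ ∑-cong (λ j → ∑-cong (λ i → pointwise (X i j) (Y i j) (Z i j))) ⟩
    ∑ (λ j → ∑ (λ i → X i j * Z i j - a * (Y i j * Z i j)))
      ≈⟨ ∑-cong (λ j → ∑-linear a (λ i → X i j * Z i j) (λ i → Y i j * Z i j)) ⟩
    ∑ (λ j → ∑ (λ i → X i j * Z i j) - a * ∑ (λ i → Y i j * Z i j))
      ≈⟨ ∑-linear a (λ j → ∑ (λ i → X i j * Z i j)) (λ j → ∑ (λ i → Y i j * Z i j)) ⟩
    ⟪ X , Z ⟫ - a * ⟪ Y , Z ⟫ ∎
    where
    pointwise : ∀ x y z → (x - a * y) * z ≈ x * z - a * (y * z)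
    pointwise x y z = trans ([y-z]x≈yx-zx z x (a * y)) (+-congˡ (-‿cong (*-assoc a y z)))

  ⟪⟫-linearʳ : ∀ {n} (a : Carrier) (X Y Z : Mat F n) →
               ⟪ Z , X ⊝ a · Y ⟫ ≈ ⟪ Z , X ⟫ - a * ⟪ Z , Y ⟫
  ⟪⟫-linearʳ a X Y Z = begin
    ⟪ Z , X ⊝ a · Y ⟫         ≈⟨ ⟪⟫-comm Z _ ⟩
    ⟪ X ⊝ a · Y , Z ⟫         ≈⟨ ⟪⟫-linearˡ a X Y Z ⟩
    ⟪ X , Z ⟫ - a * ⟪ Y , Z ⟫ ≈⟨ +-cong (⟪⟫-comm X Z) (-‿cong (*-congˡ (⟪⟫-comm Y Z))) ⟩
    ⟪ Z , X ⟫ - a * ⟪ Z , Y ⟫ ∎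

  -- Projection (Pythagoras): if β‖Y‖² = ⟨Y,X⟩, i.e. X - βY ⊥ Y, then
  -- ‖X - βY‖² = ‖X‖² - β⟨X,Y⟩.
  projection : ∀ {n} (X Y : Mat F n) (β : Carrier) → β * ‖ Y ‖² ≈ ⟪ Y , X ⟫ →
               ‖ X ⊝ β · Y ‖² ≈ ‖ X ‖² - β * ⟪ X , Y ⟫
  projection X Y β orth = begin
    ‖ X ⊝ β · Y ‖²                             ≈⟨ ⟪⟫-linearˡ β X Y (X ⊝ β · Y) ⟩
    ⟪ X , X ⊝ β · Y ⟫ - β * ⟪ Y , X ⊝ β · Y ⟫ ≈⟨ +-congˡ (-‿cong (*-congˡ Y⊥residual)) ⟩
    ⟪ X , X ⊝ β · Y ⟫ - β * 0#                 ≈⟨ +-congˡ (trans (-‿cong (zeroʳ β)) -0#≈0#) ⟩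
    ⟪ X , X ⊝ β · Y ⟫ + 0#                     ≈⟨ +-identityʳ _ ⟩
    ⟪ X , X ⊝ β · Y ⟫                          ≈⟨ ⟪⟫-linearʳ β X Y X ⟩
    ‖ X ‖² - β * ⟪ X , Y ⟫                     ∎
    where
    Y⊥residual : ⟪ Y , X ⊝ β · Y ⟫ ≈ 0#
    Y⊥residual = begin
      ⟪ Y , X ⊝ β · Y ⟫       ≈⟨ ⟪⟫-linearʳ β X Y Y ⟩
      ⟪ Y , X ⟫ - β * ‖ Y ‖² ≈⟨ +-congˡ (-‿cong orth) ⟩
      ⟪ Y , X ⟫ - ⟪ Y , X ⟫  ≈⟨ -‿inverseʳ _ ⟩
      0#                     ∎

  sq : Carrier → Carrier
  sq x = x * x

  outer-norm : ∀ {n} (d : Fin n → Carrier) →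
               ‖ (λ i j → d i * d j) ‖² ≈ ∑ (λ k → sq (d k)) * ∑ (λ k → sq (d k))
  outer-norm d = begin
    ∑ (λ j → ∑ (λ i → (d i * d j) * (d i * d j)))
      ≈⟨ ∑-cong (λ j → ∑-cong (λ i → interchange (d i) (d j) (d i) (d j))) ⟩
    ∑ (λ j → ∑ (λ i → sq (d i) * sq (d j)))
      ≈⟨ ∑-cong (λ j → ∑-scaleʳ (sq (d j)) (λ i → sq (d i))) ⟩
    ∑ (λ j → ∑ (λ i → sq (d i)) * sq (d j))
      ≈⟨ ∑-scaleˡ (∑ (λ i → sq (d i))) (λ j → sq (d j)) ⟩
    ∑ (λ k → sq (d k)) * ∑ (λ k → sq (d k)) ∎

  ∑-basis : ∀ {n} (f : Carrier → Carrier) → f 0# ≈ 0# → (v : Fin n) →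
            ∑ (λ k → f (basis F v k)) ≈ f 1#
  ∑-basis {suc n} f f0≈0 zero = trans (+-congˡ (trans (∑-cong {n} (λ _ → f0≈0)) (∑-zero {n}))) (+-identityʳ _)
  ∑-basis         f f0≈0 (suc v) = trans (+-cong f0≈0 (∑-basis f f0≈0 v)) (+-identityˡ _)

  sq[1-0] : sq (1# - 0#) ≈ 1#
  sq[1-0] = trans (*-cong 1-0≈1 1-0≈1) (*-identityˡ 1#)
    where
    1-0≈1 : 1# - 0# ≈ 1#
    1-0≈1 = trans (+-congˡ -0#≈0#) (+-identityʳ 1#)

  sq[0-1] : sq (0# - 1#) ≈ 1#
  sq[0-1] = begin
    (0# - 1#) * (0# - 1#) ≈⟨ *-cong (+-identityˡ (- 1#)) (+-identityˡ (- 1#)) ⟩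
    - 1# * - 1#           ≈⟨ -1*x≈-x (- 1#) ⟩
    - - 1#                ≈⟨ -‿involutive 1# ⟩
    1#                    ∎

  sq[0-0] : sq (0# - 0#) ≈ 0#
  sq[0-0] = trans (*-congʳ (-‿inverseʳ 0#)) (zeroˡ _)

  basis-diff-norm : ∀ {n} (u v : Fin n) → ¬ u ≡ v →
                    ∑ (λ k → sq (basis F u k - basis F v k)) ≈ 1# + 1#
  basis-diff-norm zero    zero    u≢v with () ← u≢v ≡.refl
  basis-diff-norm zero    (suc v) u≢v =
    +-cong sq[1-0] (trans (∑-basis (λ x → sq (0# - x)) sq[0-0] v) sq[0-1])
  basis-diff-norm (suc u) zero    u≢v =
    +-cong sq[0-1] (trans (∑-basis (λ x → sq (x - 0#)) sq[0-0] u) sq[1-0])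
  basis-diff-norm (suc u) (suc v) u≢v =
    trans (+-cong sq[0-0] (basis-diff-norm u v (λ u≡v → u≢v (≡.cong suc u≡v))))
          (+-identityˡ _)

  -- 4 = 1 + 1 + 1 + 1, spelled as in the statement of the theorem.
  four : Carrier
  four = 1# + 1# + 1# + 1#

  -- ‖φ_(u,v)‖² = (‖e_u - e_v‖²)² = 2 · 2 = 4 for a non-loop edge.
  φ-norm : ∀ {n} (u v : Fin n) → ¬ u ≡ v → ‖ φ F (u , v) ‖² ≈ four
  φ-norm u v u≢v = begin
    ‖ φ F (u , v) ‖²          ≈⟨ outer-norm (λ k → basis F u k - basis F v k) ⟩
    ∑ d² * ∑ d²               ≈⟨ *-cong (basis-diff-norm u v u≢v) (basis-diff-norm u v u≢v) ⟩
    (1# + 1#) * (1# + 1#)     ≈⟨ distribˡ (1# + 1#) 1# 1# ⟩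
    (1# + 1#) * 1# + (1# + 1#) * 1# ≈⟨ +-cong (*-identityʳ _) (*-identityʳ _) ⟩
    (1# + 1#) + (1# + 1#)     ≈⟨ +-assoc (1# + 1#) 1# 1# ⟨
    four                      ∎
    where
    d² : Fin _ → Carrier
    d² k = sq (basis F u k - basis F v k)

  ≤-resp₂ : ∀ {x x′ y y′} → x ≈ x′ → y ≈ y′ → x ≤ y → x′ ≤ y′
  ≤-resp₂ x≈x′ y≈y′ x≤y = ≤.≤-respˡ-≈ x≈x′ (≤.≤-respʳ-≈ y≈y′ x≤y)

  -- In an ordered field 0 ≤ 1: otherwise 0 ≤ -1, so 0 ≤ (-1)(-1) = 1 anyway.
  0≤1 : 0# ≤ 1#
  0≤1 with ≤.total 0# 1#
  ... | inj₁ 0≤1 = 0≤1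
  ... | inj₂ 1≤0 = ≤.≤-respʳ-≈ minus-one-squared (*-nonneg 0≤-1 0≤-1)
    where
    0≤-1 : 0# ≤ - 1#
    0≤-1 = ≤-resp₂ (-‿inverseʳ 1#) (+-identityˡ (- 1#)) (+-mono-≤ (- 1#) 1≤0)
    minus-one-squared : - 1# * - 1# ≈ 1#
    minus-one-squared = trans (-1*x≈-x (- 1#)) (-‿involutive 1#)

  -- Hence 1 ≤ 4 and, as 0 ≉ 1, 4 ≉ 0.
  x≤x+1 : ∀ x → x ≤ x + 1#
  x≤x+1 x = ≤-resp₂ (+-identityˡ x) (+-comm 1# x) (+-mono-≤ x 0≤1)

  four≉0 : ¬ (four ≈ 0#)
  four≉0 four≈0 = 0≉1 (≤.antisym 0≤1 (≤.≤-respʳ-≈ four≈0 1≤four))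
    where
    1≤four : 1# ≤ four
    1≤four = ≤.trans (x≤x+1 1#) (≤.trans (x≤x+1 (1# + 1#)) (x≤x+1 (1# + 1# + 1#)))

  projection-by-four : ∀ {n} (X Y : Mat F n) → ‖ Y ‖² ≈ four →
    ‖ X ⊝ (⟪ X , Y ⟫ * four ⁻¹) · Y ‖² ≈ ‖ X ‖² - (⟪ X , Y ⟫ * ⟪ X , Y ⟫) * four ⁻¹
  projection-by-four X Y ‖Y‖²≈4 = begin
    ‖ X ⊝ β · Y ‖²         ≈⟨ projection X Y β orth ⟩
    ‖ X ‖² - β * g         ≈⟨ +-congˡ (-‿cong (xy∙z≈xz∙y g (four ⁻¹) g)) ⟩
    ‖ X ‖² - (g * g) * four ⁻¹ ∎
    where
    g = ⟪ X , Y ⟫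
    β = g * four ⁻¹
    orth : β * ‖ Y ‖² ≈ ⟪ Y , X ⟫
    orth = begin
      (g * four ⁻¹) * ‖ Y ‖² ≈⟨ *-congˡ ‖Y‖²≈4 ⟩
      (g * four ⁻¹) * four   ≈⟨ xy∙z≈xz∙y g (four ⁻¹) four ⟩
      (g * four) * four ⁻¹   ≈⟨ *-assoc g four (four ⁻¹) ⟩
      g * (four * four ⁻¹)   ≈⟨ *-congˡ (⁻¹-inverse four four≉0) ⟩
      g * 1#                 ≈⟨ *-identityʳ g ⟩
      g                      ≈⟨ ⟪⟫-comm X Y ⟩
      ⟪ Y , X ⟫              ∎

  -- R_{i+1} = (L_G - α₁ L_{H_i}) - α₂ φ, the objective at the optimum.
  residual-split : ∀ {n} (L H P : Mat F n) (a b : Carrier) →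
                   L ⊝ (a · H ⊕ b · P) ≐ (L ⊝ a · H) ⊝ b · P
  residual-split L H P a b i j = begin
    L i j + - (a * H i j + b * P i j)       ≈⟨ +-congˡ (-‿+-comm _ _) ⟨
    L i j + (- (a * H i j) + - (b * P i j)) ≈⟨ +-assoc _ _ _ ⟨
    (L i j - a * H i j) - b * P i j         ∎

  -- At (α₁,α₂) = (1,β) the objective is ‖R_i - βφ‖².
  unit-scaling : ∀ {n} (L H P : Mat F n) (b : Carrier) →
                 (L ⊝ 1# · H) ⊝ b · P ≐ (L ⊝ H) ⊝ b · P
  unit-scaling L H P b i j = +-congʳ (+-congˡ (-‿cong (*-identityˡ (H i j))))

module UGAStep {c ℓ₁ ℓ₂ : Level} (F : OrderedField c ℓ₁ ℓ₂) where
  open OrderedField F hiding (zero)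
  open UGA F

  poset : Poset c ℓ₁ ℓ₂
  poset = record { isPartialOrder = IsTotalOrder.isPartialOrder isTotalOrder }

  open OrderReasoning poset

  residual-decrease : (n m : ℕ) (ends : Fin m → Fin n × Fin n) (w : Fin m → Carrier) →
    (∀ k → ¬ (proj₁ (ends k) ≡ proj₂ (ends k))) →
    (sel : ℕ → Fin m) (α₁ α₂ : ℕ → Carrier) →
    IsUGARun F ends w sel α₁ α₂ →
    ∀ (i : ℕ) →
      ‖ Res F ends w sel α₁ α₂ (suc i) ‖²
        ≤ ‖ Res F ends w sel α₁ α₂ i ‖²
          - (⟪ Res F ends w sel α₁ α₂ i , φ F (ends (sel (suc i))) ⟫
             * ⟪ Res F ends w sel α₁ α₂ i , φ F (ends (sel (suc i))) ⟫) * four ⁻¹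
  residual-decrease n m ends w no-loops sel α₁ α₂ run i = begin
    ‖ R′ ‖²                                    ≈⟨ ⟪⟫-cong split split ⟩
    ‖ (L ⊝ α₁ (suc i) · H) ⊝ α₂ (suc i) · P ‖² ≤⟨ proj₂ (run i) 1# β ⟩
    ‖ (L ⊝ 1# · H) ⊝ β · P ‖²                  ≈⟨ ⟪⟫-cong unit unit ⟩
    ‖ R ⊝ β · P ‖²                             ≈⟨ projection-by-four R P (φ-norm _ _ (no-loops (sel (suc i)))) ⟩
    ‖ R ‖² - (⟪ R , P ⟫ * ⟪ R , P ⟫) * four ⁻¹ ∎
    where
    L = laplacian F ends w
    H = LH F ends sel α₁ α₂ i
    P = φ F (ends (sel (suc i)))
    R = Res F ends w sel α₁ α₂ i
    R′ = Res F ends w sel α₁ α₂ (suc i)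
    β = ⟪ R , P ⟫ * four ⁻¹
    split = residual-split L H P (α₁ (suc i)) (α₂ (suc i))
    unit = unit-scaling L H P β

lemma3p7 : ∀ {c ℓ₁ ℓ₂ : Level} (F : OrderedField c ℓ₁ ℓ₂) →
    let open OrderedField F in
    (n m : ℕ) (ends : Fin m → Fin n × Fin n) (w : Fin m → Carrier) →
    (∀ k → ¬ (proj₁ (ends k) ≡ proj₂ (ends k))) →
    (∀ k → 0# < w k) →
    (sel : ℕ → Fin m) (α₁ α₂ : ℕ → Carrier) →
    IsUGARun F ends w sel α₁ α₂ →
    ∀ (i : ℕ) →
      ‖_‖²F F (Res F ends w sel α₁ α₂ (suc i))
        ≤ ‖_‖²F F (Res F ends w sel α₁ α₂ i)
          - (⟨_,_⟩ F (Res F ends w sel α₁ α₂ i) (φ F (ends (sel (suc i))))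
             * ⟨_,_⟩ F (Res F ends w sel α₁ α₂ i) (φ F (ends (sel (suc i)))))
            * ((1# + 1# + 1# + 1#) ⁻¹)
lemma3p7 F n m ends w no-loops _ = UGAStep.residual-decrease F n m ends w no-loops
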